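{- Fix $b\in\{0,1\}^{\mathbb{N}}$. For $u=[u_0,\dots,u_{n-1}]\in\mathbb{N}^\ast$ and $x,y\in\mathbb{N}$ let $P(u,x,y):\equiv u_{n-1}<x\wedge((b_x=1\wedge x\le y)\to b_y=1)$, the conjunct $u_{n-1}<x$ being omitted when $u=[\,]$. Let $\mathcal{A}$ be the approximation algorithm of sort $\mathbb{N}^\ast,\mathbb{N},\mathbb{N}$ with registers $R:=\{\mathsf{s},\mathsf{e}_1,\mathsf{e}_2\}\times\mathbb{N}$ (symbols $\mathsf{s},\mathsf{e}_1,\mathsf{e}_2$), query states $\langle(\mathsf{s},x)\mid\Box\rangle$ and $\langle(\mathsf{e}_1,x)\mid\Box\rangle$ ($x\in\mathbb{N}$), end states $\langle(\mathsf{e}_i,x)\mid y\rangle$ ($i\in\{1,2\}$, $x,y\in\mathbb{N}$), $\rho(u):=(\mathsf{s},u_{n-1}+1)$ for nonempty $u$ of length $n$, $\rho([\,]):=(\mathsf{s},0)$, $\xi(c,x):=x$, and the transition $\langle(\mathsf{s},x)\mid y\rangle\rhd\langle(\mathsf{e}_1,y)\mid\Box\rangle$ if $b_x=1\wedge x\le y\wedge b_y=0$, and $\langle(\mathsf{s},x)\mid y\rangle\rhd\langle(\mathsf{e}_2,x)\mid y\rangle$ otherwise. Then $\mathcal{A}$ satisfies $P$ and terminates.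
   Context: $\mathbb{N}^\ast$ is the set of finite sequences of natural numbers. Approximation algorithm of sort $U,X,Y$: tuple $(R,Q,E,\rho,\xi,\rhd)$ with states $\langle r\mid o\rangle$ ($r\in R$, $o\in Y\cup\{\Box\}$, $\Box$ fresh), query states $Q\subseteq\{\langle r\mid\Box\rangle\}$, end states $E\subseteq\{\langle r\mid y\rangle: y\in Y\}$ with $Q\cap E=\emptyset$, $\rho:U\to R$, $\xi:R\to X$, $\rhd$ a partial function on states. A run on an oracle $f:X\to Y$ is a finite sequence $s_0,\dots,s_m$ with $s_i\notin E$ for $i<m$, $s_{i+1}=\langle r\mid f(\xi(r))\rangle$ if $s_i=\langle r\mid\Box\rangle\in Q$, and $s_{i+1}=\rhd(s_i)$ (defined) otherwise. $\mathcal{A}$ satisfies $P$: for every $u$ and oracle $f$, a run on $f$ from $\langle\rho(u)\mid\Box\rangle$ to $\langle r\mid y\rangle\in E$ implies $P(u,\xi(r),y)$. $\mathcal{A}$ terminates: for every $u$ and every oracle $f$ there is a run on $f$ from $\langle\rho(u)\mid\Box\rangle$ to an end state. -}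

module Defs where

open import Data.Nat using (ℕ; suc; _≤_; _<_; _≤ᵇ_)
open import Data.Bool using (Bool; true; false; _∧_; not; if_then_else_)
open import Data.List using (List; []; _∷_)
open import Data.Maybe using (Maybe; just; nothing)
open import Data.Product using (Σ; _×_; _,_)
open import Data.Unit using (⊤)
open import Data.Empty using (⊥)
open import Relation.Nullary using (¬_)
open import Relation.Binary.PropositionalEquality using (_≡_)

-- Generic approximation algorithms of sort U, X, Y.
-- A state ⟨ r ∣ o ⟩ is a pair (r , o) with o : Maybe Y, where
-- nothing plays the role of the fresh symbol □.

State : Set → Set → Set
State R Y = R × Maybe Y

record ApproxAlg (U X Y : Set) : Set₁ where
  field
    R   : Set
    Q   : R → Set
    E   : R → Y → Set
    ρ   : U → R
    ξ   : R → X
    step▷ : State R Y → Maybe (State R Y)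
  -- Q ⊆ {⟨r∣□⟩}, E ⊆ {⟨r∣y⟩}, hence Q ∩ E = ∅ by construction.

  IsQuery : State R Y → Set
  IsQuery (r , nothing) = Q r
  IsQuery (r , just _)  = ⊥

  IsEnd : State R Y → Set
  IsEnd (r , nothing) = ⊥
  IsEnd (r , just y)  = E r y

  data Step (f : X → Y) : State R Y → State R Y → Set where
    query : ∀ {r} → Q r → Step f (r , nothing) (r , just (f (ξ r)))
    trans : ∀ {s s'} → ¬ IsQuery s → step▷ s ≡ just s' → Step f s s'

  data Run (f : X → Y) : State R Y → State R Y → Set where
    done : ∀ {s} → Run f s s
    next : ∀ {s s' t} → ¬ IsEnd s → Step f s s' → Run f s' t → Run f s t

open ApproxAlg public

Satisfies : ∀ {U X Y} → (𝒜 : ApproxAlg U X Y) → (U → X → Y → Set) → Set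
Satisfies {U} {X} {Y} 𝒜 P =
  (u : U) (f : X → Y) (r : R 𝒜) (y : Y) →
  Run 𝒜 f (ρ 𝒜 u , nothing) (r , just y) → E 𝒜 r y → P u (ξ 𝒜 r) y

Terminates : ∀ {U X Y} → ApproxAlg U X Y → Set
Terminates {U} {X} {Y} 𝒜 =
  (u : U) (f : X → Y) →
  Σ (State (R 𝒜) Y) λ t → Run 𝒜 f (ρ 𝒜 u , nothing) t × IsEnd 𝒜 t

lastElem : List ℕ → Maybe ℕ
lastElem []           = nothing
lastElem (x ∷ [])     = just x
lastElem (x ∷ y ∷ xs) = lastElem (y ∷ xs)

LastBelow : List ℕ → ℕ → Set
LastBelow u x with lastElem u
... | nothing = ⊤
... | just l  = l < x

P6 : (ℕ → Bool) → List ℕ → ℕ → ℕ → Set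
P6 b u x y = LastBelow u x × ((b x ≡ true × x ≤ y) → b y ≡ true)

data Sym : Set where
  s e₁ e₂ : Sym

Reg : Set
Reg = Sym × ℕ

Q6 : Reg → Set
Q6 (s  , _) = ⊤
Q6 (e₁ , _) = ⊤
Q6 (e₂ , _) = ⊥

E6 : Reg → ℕ → Set
E6 (s  , _) _ = ⊥
E6 (e₁ , _) _ = ⊤
E6 (e₂ , _) _ = ⊤

ρ6 : List ℕ → Reg
ρ6 u with lastElem u
... | nothing = (s , 0)
... | just l  = (s , suc l)

ξ6 : Reg → ℕ
ξ6 (_ , x) = x

▷6 : (ℕ → Bool) → State Reg ℕ → Maybe (State Reg ℕ)
▷6 b ((s , x) , just y) =
  if b x ∧ (x ≤ᵇ y) ∧ not (b y)
  then just ((e₁ , y) , nothing)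
  else just ((e₂ , x) , just y)
▷6 b _ = nothing

𝒜6 : (ℕ → Bool) → ApproxAlg (List ℕ) ℕ ℕ
𝒜6 b = record
  { R = Reg ; Q = Q6 ; E = E6 ; ρ = ρ6 ; ξ = ξ6 ; step▷ = ▷6 b }

module Submission where

-- Runs of an approximation algorithm are deterministic: from a
-- given state at most one step is possible (a query state only answers its
-- query, every other state only follows ▷, which is a function).  Hence all
-- runs from a state that reach an end state reach the same one.  For the
-- algorithm 𝒜6 started in ⟨(s,x) ∣ □⟩ we write down that end state
-- explicitly: after the query the register holds y = f x; if the "violation
-- test" bₓ = 1 ∧ x ≤ y ∧ b_y = 0 succeeds we move to ⟨(e₁,y) ∣ □⟩ and end
-- in ⟨(e₁,y) ∣ f y⟩, otherwise we end in ⟨(e₂,x) ∣ y⟩.  Termination is this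
-- canonical run.  Correctness reduces, by uniqueness of end states, to
-- checking P on the canonical end state: its position is ≥ x > u_{n-1}, and
-- the implication holds because the e₁ branch answers a point y with b_y = 0
-- (so its premise fails), while in the e₂ branch the test failed.

open import Defs
open import Data.Nat using (ℕ; _≤_; _≤ᵇ_)
open import Data.Nat.Properties using (≤ᵇ⇒≤; ≤⇒≤ᵇ; ≤-refl)
open import Data.Bool using (Bool; true; false; _∧_; not; if_then_else_)
open import Data.Bool.Properties using (T-≡)
open import Data.List using (List)
open import Data.Maybe using (just; nothing)
open import Data.Maybe.Properties using (just-injective)
open import Data.Product using (_×_; _,_)
open import Data.Unit using (tt)
open import Function.Bundles using (Equivalence)
open import Relation.Nullary using (contradiction)
open import Relation.Binary.PropositionalEquality
  using (_≡_; refl; sym; subst)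
  renaming (trans to ≡-trans)

module _ {U X Y : Set} (𝒜 : ApproxAlg U X Y) (f : X → Y) where

  step-deterministic : ∀ {s t t'} → Step 𝒜 f s t → Step 𝒜 f s t' → t ≡ t'
  step-deterministic (query _)     (query _)      = refl
  step-deterministic (query q)     (trans ¬q _)   = contradiction q ¬q
  step-deterministic (trans ¬q _)  (query q)      = contradiction q ¬q
  step-deterministic (trans _ eq)  (trans _ eq')  = just-injective (≡-trans (sym eq) eq')

  -- Two runs from the same state that both stop in an end state stop in the
  -- same one (a run cannot pass through an end state).
  end-unique : ∀ {s t t'} → Run 𝒜 f s t → IsEnd 𝒜 t →
               Run 𝒜 f s t' → IsEnd 𝒜 t' → t ≡ t'
  end-unique done            _   done               _    = refl
  end-unique done            end (next ¬end _ _)    _    = contradiction end ¬end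
  end-unique (next ¬end _ _) _   done               end' = contradiction end' ¬end
  end-unique (next _ st run) end (next _ st' run')  end'
    with step-deterministic st st'
  ... | refl = end-unique run end run' end'

∧-not-true : ∀ p q r → p ∧ q ∧ not r ≡ true → q ≡ true × r ≡ false
∧-not-true true true false _ = refl , refl
∧-not-true true true true ()
∧-not-true true false _ ()
∧-not-true false _ _ ()

∧-not-false : ∀ p q r → p ∧ q ∧ not r ≡ false → p ≡ true → q ≡ true → r ≡ true
∧-not-false true true true  _ _ _ = refl
∧-not-false true true false ()

module _ (b : ℕ → Bool) where

  violation : ℕ → ℕ → Bool
  violation x y = b x ∧ (x ≤ᵇ y) ∧ not (b y)

  violation-true : ∀ x y → violation x y ≡ true → x ≤ y × b y ≡ false
  violation-true x y v with ∧-not-true (b x) (x ≤ᵇ y) (b y) v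
  ... | x≤ᵇy , by = ≤ᵇ⇒≤ x y (Equivalence.from T-≡ x≤ᵇy) , by

  violation-false : ∀ x y → violation x y ≡ false → b x ≡ true → x ≤ y → b y ≡ true
  violation-false x y v bx x≤y =
    ∧-not-false (b x) (x ≤ᵇ y) (b y) v bx (Equivalence.to T-≡ (≤⇒≤ᵇ x≤y))

  afterTest : Bool → ℕ → ℕ → State Reg ℕ
  afterTest true  x y = (e₁ , y) , nothing
  afterTest false x y = (e₂ , x) , just y

  afterTest-if : ∀ c x y →
    (if c then just ((e₁ , y) , nothing) else just ((e₂ , x) , just y))
      ≡ just (afterTest c x y)
  afterTest-if true  _ _ = refl
  afterTest-if false _ _ = refl

  ▷6-after-query : ∀ x y → ▷6 b ((s , x) , just y) ≡ just (afterTest (violation x y) x y)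
  ▷6-after-query x y = afterTest-if (violation x y) x y

  module _ (f : ℕ → ℕ) where

    endState : Bool → ℕ → State Reg ℕ
    endState true  x = (e₁ , f x) , just (f (f x))
    endState false x = (e₂ , x) , just (f x)

    endState-isEnd : ∀ c x → IsEnd (𝒜6 b) (endState c x)
    endState-isEnd true  _ = tt
    endState-isEnd false _ = tt

    finishRun : ∀ c x → Run (𝒜6 b) f (afterTest c x (f x)) (endState c x)
    finishRun true  _ = next (λ ()) (query tt) done
    finishRun false _ = done

    canonicalEnd : ℕ → State Reg ℕ
    canonicalEnd x = endState (violation x (f x)) x

    canonicalEnd-isEnd : ∀ x → IsEnd (𝒜6 b) (canonicalEnd x)
    canonicalEnd-isEnd x = endState-isEnd (violation x (f x)) x

    canonicalRun : ∀ x → Run (𝒜6 b) f ((s , x) , nothing) (canonicalEnd x)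
    canonicalRun x =
      next (λ ()) (query tt)
        (next (λ ()) (trans (λ ()) (▷6-after-query x (f x)))
          (finishRun (violation x (f x)) x))

    canonical-satisfies : ∀ u x → (∀ z → x ≤ z → LastBelow u z) →
      ∀ {r y} → canonicalEnd x ≡ (r , just y) → P6 b u (ξ6 r) y
    canonical-satisfies u x above eq with violation x (f x) in v | eq
    ... | true | refl with violation-true x (f x) v
    -- e₁ branch: the answered point f x has b (f x) = 0, so the premise fails.
    ...   | x≤fx , bfx = above (f x) x≤fx , λ (bfx' , _) → contradiction (≡-trans (sym bfx') bfx) λ ()
    -- e₂ branch: the test failed, which is exactly the implication in P.
    canonical-satisfies u x above eq | false | refl =
      above x ≤-refl , λ (bx , x≤fx) → violation-false x (f x) v bx x≤fx

start : List ℕ → ℕ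
start u = ξ6 (ρ6 u)

ρ6-start : ∀ u → ρ6 u ≡ (s , start u)
ρ6-start u with lastElem u
... | nothing = refl
... | just _  = refl

start-above : ∀ u z → start u ≤ z → LastBelow u z
start-above u z start≤z with lastElem u
... | nothing = tt
... | just _  = start≤z

lemma6p3 : (b : ℕ → Bool) → Satisfies (𝒜6 b) (P6 b) × Terminates (𝒜6 b)
lemma6p3 b = satisfies , terminates
  where
  runFrom : ∀ f u {t} → Run (𝒜6 b) f ((s , start u) , nothing) t → Run (𝒜6 b) f (ρ6 u , nothing) t
  runFrom f u {t} = subst (λ r → Run (𝒜6 b) f (r , nothing) t) (sym (ρ6-start u))

  terminates : Terminates (𝒜6 b)
  terminates u f =
    canonicalEnd b f (start u) , runFrom f u (canonicalRun b f (start u)) , canonicalEnd-isEnd b f (start u)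

  satisfies : Satisfies (𝒜6 b) (P6 b)
  satisfies u f r y run end =
    canonical-satisfies b f u (start u) (start-above u)
      (end-unique (𝒜6 b) f (runFrom f u (canonicalRun b f (start u)))
                  (canonicalEnd-isEnd b f (start u)) run end)
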